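{- Let $Q$ be an orbit-finite equivariant set with the integer atoms and fix an equivalence signature $\Phi=(\sim,\mathrm{diff},\mathrm{char})$ on $Q$. Let $f_1,f_2:\mathbb{Z}\to Q$ be given by $f_1(x)=(\tau_1,a_1x+b_1)$ and $f_2(x)=(\tau_2,a_2x+b_2)$ for orbits $\tau_1\sim\tau_2$ and $a_1,b_1,a_2,b_2\in\mathbb{Z}$. Let $X\subseteq\mathbb{Z}$ be a finite arithmetic progression $a+p\cdot\{0,\ldots,k\}$ or an infinite arithmetic progression $a+p\cdot\mathbb{N}$ (with $a,p\in\mathbb{Z}$, possibly negative). Then for any two consecutive elements $x_0,x_1$ of $X$: $\forall x\in X\ \ f_1(x)\equiv_\Phi f_2(x)$ if and only if $f_1(x_0)\equiv_\Phi f_2(x_0)$ and $f_1(x_1)\equiv_\Phi f_2(x_1)$.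
   Context: Integer atoms: atoms are $\mathbb{Z}$ with successor; automorphisms are translations $x\mapsto x+z$. Equivariant = invariant under all translations; orbit-finite = finite union of orbits. For $k\ge1$, $\mathbb{Z}_k$ is the integers mod $k$ with translations acting by addition, $\mathbb{Z}_0=\mathbb{Z}$; each orbit $\tau$ of $Q$ is equivariantly isomorphic to $\mathbb{Z}_{k_\tau}$ for a unique $k_\tau$; fix such isomorphisms and write $(\tau,i)$ for the image of $i\bmod k_\tau$. An equivalence signature is a triple $(\sim,\mathrm{diff},\mathrm{char})$: $\sim$ an equivalence on orbits of $Q$, $\mathrm{diff}(\tau,\sigma)\in\mathbb{Z}$ for $\tau\sim\sigma$, $\mathrm{char}(\Sigma)\in\mathbb{N}$ for each class $\Sigma$ (write $\mathrm{char}(\tau)$ for $\tau\in\Sigma$), such that $\mathrm{diff}(\tau_1,\tau_2)+\mathrm{diff}(\tau_2,\tau_3)\equiv\mathrm{diff}(\tau_1,\tau_3)\pmod{\mathrm{char}(\Sigma)}$ for $\tau_i\in\Sigma$ and $k_\tau\equiv0\pmod{\mathrm{char}(\Sigma)}$ for $\tau\in\Sigma$ (mod $0$ means equality). $\equiv_\Phi$ is the smallest equivalence relation on $Q$ containing all pairs $((\tau,i),(\tau,i+\mathrm{char}(\tau)))$ and $((\tau,i),(\sigma,i+\mathrm{diff}(\tau,\sigma)))$ for $i\in\mathbb{Z}$, $\tau\sim\sigma$. Two elements of an arithmetic progression $a+p\cdot I$ are consecutive if they are $a+pj$ and $a+p(j+1)$. -}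

module Defs where

open import Data.Nat as ℕ using (ℕ; suc; _≤_)
open import Data.Nat.Divisibility using () renaming (_∣_ to _∣ℕ_)
open import Data.Integer using (ℤ; +_; _+_; _-_; _*_)
open import Data.Integer.Divisibility as ℤD using ()
open import Data.Fin using (Fin)
open import Data.Product using (_×_; _,_; ∃-syntax)
open import Data.Unit using (⊤)
open import Relation.Binary.Structures using (IsEquivalence)
open import Relation.Binary.PropositionalEquality using (_≡_)

-- congruence modulo m ∈ ℕ on ℤ; modulo 0 means equality
_≡_[mod_] : ℤ → ℤ → ℕ → Set
a ≡ b [mod m ] = (+ m) ℤD.∣ (a - b)

-- An orbit-finite equivariant set Q over the integer atoms, presented via the
-- fixed isomorphisms of its orbits with ℤ_{k_τ}: n orbits (indexed by Fin n),
-- orbit τ has k τ as its k_τ. An element (τ , i) stands for (τ, i mod k τ).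
Elt : ℕ → Set
Elt n = Fin n × ℤ

_≈Q_ : ∀ {n} {k : Fin n → ℕ} → Elt n → Elt n → Set
_≈Q_ {k = k} (τ , i) (σ , j) = (τ ≡ σ) × (i ≡ j [mod k τ ])

-- Equivalence signature (∼ , diff , char) on Q.  char is given per orbit and
-- required to be constant on ∼-classes (i.e. char(Σ) for the class Σ).
record Signature (n : ℕ) (k : Fin n → ℕ) : Set₁ where
  field
    _∼_        : Fin n → Fin n → Set
    ∼-equiv    : IsEquivalence _∼_
    diff       : Fin n → Fin n → ℤ      -- only used for related orbits
    char       : Fin n → ℕ
    char-class : ∀ {τ σ} → τ ∼ σ → char τ ≡ char σ
    cocycle    : ∀ {τ₁ τ₂ τ₃} → τ₁ ∼ τ₂ → τ₂ ∼ τ₃ →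
                 (diff τ₁ τ₂ + diff τ₂ τ₃) ≡ diff τ₁ τ₃ [mod char τ₁ ]
    char-div   : ∀ τ → char τ ∣ℕ k τ

data EqΦ {n : ℕ} {k : Fin n → ℕ} (Φ : Signature n k) : Elt n → Elt n → Set where
  same     : ∀ {x y} → _≈Q_ {k = k} x y → EqΦ Φ x y
  gen-char : ∀ τ i → EqΦ Φ (τ , i) (τ , i + + Signature.char Φ τ)
  gen-diff : ∀ {τ σ} → Signature._∼_ Φ τ σ → ∀ i →
             EqΦ Φ (τ , i) (σ , i + Signature.diff Φ τ σ)
  eq-sym   : ∀ {x y} → EqΦ Φ x y → EqΦ Φ y x
  eq-trans : ∀ {x y z} → EqΦ Φ x y → EqΦ Φ y z → EqΦ Φ x z

affine : ∀ {n} → Fin n → ℤ → ℤ → ℤ → Elt n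
affine τ a b x = (τ , a * x + b)

-- shape of an arithmetic progression a + p·I: I = {0..K} or I = ℕ
data APShape : Set where
  finite   : ℕ → APShape
  infinite : APShape

InIdx : APShape → ℕ → Set
InIdx (finite K) j = j ≤ K
InIdx infinite   j = ⊤

InAP : APShape → ℤ → ℤ → ℤ → Set
InAP s a p x = ∃[ j ] (InIdx s j × x ≡ a + p * + j)

module Submission where

-- Proof idea.  For orbits τ ∼ σ, the relation ≡_Φ between (τ , i) and (σ , j)
-- is decided by a single divisibility:
--
--     (τ , i) ≡_Φ (σ , j)   iff   char τ ∣ i + diff τ σ - j .
--
-- Soundness (⇒) is an induction over the derivation of ≡_Φ, using the cocycle
-- condition to see that diff τ τ and diff τ σ + diff σ τ are multiples of the
-- characteristic.  Completeness (⇐) first moves from (τ , i) to (σ , i + diff τ σ)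
-- by one generating pair and then along σ by a multiple of char σ.
--
-- For the two affine maps, the quantity i + diff - j evaluated at the points
-- a + p·t of a progression is an affine function u + v·t of the index t.  An
-- integer dividing an affine function at two consecutive arguments divides it
-- at every argument, so ≡_Φ at two consecutive points of the progression
-- propagates to all of them; this is the nontrivial direction of lemma9.

open import Defs
open import Data.Nat using (ℕ; suc; zero)
open import Data.Integer using (ℤ; +_; -[1+_]; _+_; _*_; _-_; -_; 0ℤ; 1ℤ)
open import Data.Integer.Properties using (+-inverseʳ)
open import Data.Integer.Divisibility.Signed
  using (_∣_; divides; ∣ᵤ⇒∣; ∣⇒∣ᵤ; ∣-refl; ∣-trans; ∣m∣n⇒∣m+n; ∣m∣n⇒∣m-n; ∣n⇒∣m*n)
open import Data.Integer.Tactic.RingSolver using (solve-∀)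
open import Data.Fin using (Fin)
open import Data.Product using (_×_; _,_; proj₂)
open import Function.Bundles using (_⇔_; mk⇔; Equivalence)
open import Relation.Binary.PropositionalEquality using (_≡_; refl; subst; sym; cong; module ≡-Reasoning)
open import Relation.Binary.Structures using (IsEquivalence)

∣-resp : ∀ {c x y} → x ≡ y → c ∣ x → c ∣ y
∣-resp {c} = subst (c ∣_)

∣0 : ∀ {c} → c ∣ 0ℤ
∣0 = divides 0ℤ refl

mod⇒∣ : ∀ x y {m} → x ≡ y [mod m ] → + m ∣ x - y
mod⇒∣ x y {m} = ∣ᵤ⇒∣ {+ m} {x - y}

∣⇒mod : ∀ x y {m} → + m ∣ x - y → x ≡ y [mod m ]
∣⇒mod x y {m} = ∣⇒∣ᵤ {+ m} {x - y}

-- Two-point principle for affine functions: if c divides u + v·t at two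
-- consecutive arguments s and s + 1, then it divides the slope v and hence
-- u + v·t for every integer t.
affine-two-point : ∀ {c} u v s → c ∣ u + v * s → c ∣ u + v * (1ℤ + s) →
                   ∀ t → c ∣ u + v * t
affine-two-point {c} u v s at-s at-s+1 t =
  ∣-resp (expand u v s t) (∣m∣n⇒∣m+n at-s (∣n⇒∣m*n (t - s) slope))
  where
  slope-eq : ∀ u v s → (u + v * (1ℤ + s)) - (u + v * s) ≡ v
  slope-eq = solve-∀
  expand : ∀ u v s t → (u + v * s) + (t - s) * v ≡ u + v * t
  expand = solve-∀
  slope : c ∣ v
  slope = ∣-resp (slope-eq u v s) (∣m∣n⇒∣m-n at-s+1 at-s)

offset-along-progression :
  ∀ a₁ b₁ a₂ b₂ d a p t →
  (a₁ * (a + p * t) + b₁) + d - (a₂ * (a + p * t) + b₂)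
  ≡ ((a₁ * a + b₁) + d - (a₂ * a + b₂)) + ((a₁ - a₂) * p) * t
offset-along-progression = solve-∀

module _ {n : ℕ} {k : Fin n → ℕ} (Φ : Signature n k) where
  open Signature Φ
  open IsEquivalence ∼-equiv
    using () renaming (refl to ∼-refl; sym to ∼-sym; trans to ∼-trans)

  charℤ : Fin n → ℤ
  charℤ τ = + char τ

  defect : Fin n → Fin n → ℤ → ℤ → ℤ
  defect τ σ i j = i + diff τ σ - j

  char-transport : ∀ {τ σ z} → τ ∼ σ → charℤ σ ∣ z → charℤ τ ∣ z
  char-transport {z = z} r = subst (λ c → + c ∣ z) (sym (char-class r))

  char∣size : ∀ τ → charℤ τ ∣ + k τ
  char∣size τ = ∣ᵤ⇒∣ {charℤ τ} {+ k τ} (char-div τ)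

  cocycle∣ : ∀ {τ₁ τ₂ τ₃} → τ₁ ∼ τ₂ → τ₂ ∼ τ₃ →
             charℤ τ₁ ∣ (diff τ₁ τ₂ + diff τ₂ τ₃) - diff τ₁ τ₃
  cocycle∣ {τ₁} {τ₂} {τ₃} r s =
    mod⇒∣ (diff τ₁ τ₂ + diff τ₂ τ₃) (diff τ₁ τ₃) (cocycle r s)

  -- Taking τ₁ = τ₂ = τ₃ in the cocycle condition: diff τ τ ≡ 0 modulo char τ.
  diff-refl : ∀ τ → charℤ τ ∣ diff τ τ
  diff-refl τ = ∣-resp (cancel (diff τ τ)) (cocycle∣ (∼-refl {τ}) (∼-refl {τ}))
    where
    cancel : ∀ d → (d + d) - d ≡ d
    cancel = solve-∀

  -- Taking τ₃ = τ₁: diff τ σ + diff σ τ ≡ 0 modulo char τ.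
  diff-sym : ∀ {τ σ} → τ ∼ σ → charℤ τ ∣ diff τ σ + diff σ τ
  diff-sym {τ} r =
    ∣-resp (cancel _ _) (∣m∣n⇒∣m+n (cocycle∣ r (∼-sym r)) (diff-refl τ))
    where
    cancel : ∀ u v → (u - v) + v ≡ u
    cancel = solve-∀

  Congruent : Elt n → Elt n → Set
  Congruent (τ , i) (σ , j) = τ ∼ σ × charℤ τ ∣ defect τ σ i j

  sound : ∀ {x y} → EqΦ Φ x y → Congruent x y
  sound {τ , i} {_ , j} (same (refl , i≡j)) =
    ∼-refl , ∣-resp (regroup i j (diff τ τ))
                    (∣m∣n⇒∣m+n (∣-trans (char∣size τ) (mod⇒∣ i j i≡j)) (diff-refl τ))
    where
    regroup : ∀ i j d → (i - j) + d ≡ i + d - j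
    regroup = solve-∀
  sound (gen-char τ i) =
    ∼-refl , ∣-resp (regroup i (diff τ τ) (charℤ τ)) (∣m∣n⇒∣m-n (diff-refl τ) ∣-refl)
    where
    regroup : ∀ i d c → d - c ≡ i + d - (i + c)
    regroup = solve-∀
  sound (gen-diff {τ} {σ} r i) = r , ∣-resp (sym (vanish i (diff τ σ))) ∣0
    where
    vanish : ∀ i d → i + d - (i + d) ≡ 0ℤ
    vanish = solve-∀
  sound (eq-sym {τ , i} {σ , j} p) with sound p
  ... | r , m = ∼-sym r , char-transport (∼-sym r)
                  (∣-resp (regroup i j (diff τ σ) (diff σ τ)) (∣m∣n⇒∣m-n (diff-sym r) m))
    where
    regroup : ∀ i j d e → (d + e) - (i + d - j) ≡ j + e - i
    regroup = solve-∀
  sound (eq-trans {τ , i} {σ , j} {ρ , l} p q) with sound p | sound q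
  ... | r , m | s , m′ =
    ∼-trans r s ,
    ∣-resp (regroup i j l (diff τ σ) (diff σ ρ) (diff τ ρ))
      (∣m∣n⇒∣m-n (∣m∣n⇒∣m+n m (char-transport r m′)) (cocycle∣ r s))
    where
    regroup : ∀ i j l d e f → (i + d - j) + (j + e - l) - ((d + e) - f) ≡ i + f - l
    regroup = solve-∀

  ≡⇒EqΦ : ∀ {σ x y} → x ≡ y → EqΦ Φ (σ , x) (σ , y)
  ≡⇒EqΦ {σ} {x} refl = same (refl , ∣⇒mod x x (∣-resp (sym (+-inverseʳ x)) ∣0))

  shift-ℕ : ∀ σ x m → EqΦ Φ (σ , x) (σ , x + + m * charℤ σ)
  shift-ℕ σ x zero    = ≡⇒EqΦ (no-shift x (charℤ σ))
    where
    no-shift : ∀ x c → x ≡ x + 0ℤ * c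
    no-shift = solve-∀
  shift-ℕ σ x (suc m) =
    eq-trans (shift-ℕ σ x m)
      (eq-trans (gen-char σ _) (≡⇒EqΦ (one-more x (+ m) (charℤ σ))))
    where
    one-more : ∀ x m c → (x + m * c) + c ≡ x + (1ℤ + m) * c
    one-more = solve-∀

  shift : ∀ σ x q → EqΦ Φ (σ , x) (σ , x + q * charℤ σ)
  shift σ x (+ m)    = shift-ℕ σ x m
  shift σ x -[1+ m ] =
    eq-sym (eq-trans (shift-ℕ σ _ (suc m)) (≡⇒EqΦ (undo x (+ suc m) (charℤ σ))))
    where
    undo : ∀ x m c → (x + (- m) * c) + m * c ≡ x
    undo = solve-∀

  complete : ∀ {τ σ i j} → τ ∼ σ → charℤ τ ∣ defect τ σ i j → EqΦ Φ (τ , i) (σ , j)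
  complete {τ} {σ} {i} {j} r m with char-transport (∼-sym r) m
  ... | divides q eq =
    eq-trans (gen-diff r i)
      (eq-trans (shift σ _ (- q)) (≡⇒EqΦ (sym (solve-for-j (i + diff τ σ) j q (charℤ σ) eq))))
    where
    solve-for-j : ∀ y j q c → y - j ≡ q * c → j ≡ y + (- q) * c
    solve-for-j y j q c e = begin
      j               ≡⟨ back y j ⟩
      y - (y - j)     ≡⟨ cong (λ z → y - z) e ⟩
      y - q * c       ≡⟨ negate y q c ⟩
      y + (- q) * c   ∎
      where
      open ≡-Reasoning
      back : ∀ y j → j ≡ y - (y - j)
      back = solve-∀
      negate : ∀ y q c → y - q * c ≡ y + (- q) * c
      negate = solve-∀

  EqΦ⇔defect : ∀ {τ σ i j} → τ ∼ σ → EqΦ Φ (τ , i) (σ , j) ⇔ charℤ τ ∣ defect τ σ i j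
  EqΦ⇔defect r = mk⇔ (λ e → proj₂ (sound e)) (complete r)

  progression-two-point :
    ∀ {τ σ} → τ ∼ σ → ∀ a₁ b₁ a₂ b₂ a p s →
    EqΦ Φ (affine τ a₁ b₁ (a + p * s)) (affine σ a₂ b₂ (a + p * s)) →
    EqΦ Φ (affine τ a₁ b₁ (a + p * (1ℤ + s))) (affine σ a₂ b₂ (a + p * (1ℤ + s))) →
    ∀ t → EqΦ Φ (affine τ a₁ b₁ (a + p * t)) (affine σ a₂ b₂ (a + p * t))
  progression-two-point {τ} {σ} r a₁ b₁ a₂ b₂ a p s at-s at-s+1 t =
    Equivalence.from (EqΦ⇔defect r)
      (∣-resp (sym (along t))
        (affine-two-point u v s (as-affine s at-s) (as-affine (1ℤ + s) at-s+1) t))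
    where
    u v : ℤ
    u = (a₁ * a + b₁) + diff τ σ - (a₂ * a + b₂)
    v = (a₁ - a₂) * p
    along : ∀ t → defect τ σ (a₁ * (a + p * t) + b₁) (a₂ * (a + p * t) + b₂) ≡ u + v * t
    along = offset-along-progression a₁ b₁ a₂ b₂ (diff τ σ) a p
    as-affine : ∀ t → EqΦ Φ (affine τ a₁ b₁ (a + p * t)) (affine σ a₂ b₂ (a + p * t)) →
                charℤ τ ∣ u + v * t
    as-affine t e = ∣-resp (along t) (Equivalence.to (EqΦ⇔defect r) e)

lemma9 : (n : ℕ) (k : Fin n → ℕ) (Φ : Signature n k)
         (τ₁ τ₂ : Fin n) → Signature._∼_ Φ τ₁ τ₂ →
         (a₁ b₁ a₂ b₂ : ℤ) (s : APShape) (a p : ℤ)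
         (j : ℕ) → InIdx s j → InIdx s (suc j) →
         (∀ x → InAP s a p x → EqΦ Φ (affine τ₁ a₁ b₁ x) (affine τ₂ a₂ b₂ x))
         ⇔ (EqΦ Φ (affine τ₁ a₁ b₁ (a + p * + j)) (affine τ₂ a₂ b₂ (a + p * + j))
            × EqΦ Φ (affine τ₁ a₁ b₁ (a + p * + suc j)) (affine τ₂ a₂ b₂ (a + p * + suc j)))
lemma9 n k Φ τ₁ τ₂ r a₁ b₁ a₂ b₂ s a p j j∈ j+1∈ = mk⇔ restrict extend
  where
  Related : ℤ → Set
  Related x = EqΦ Φ (affine τ₁ a₁ b₁ x) (affine τ₂ a₂ b₂ x)
  restrict : (∀ x → InAP s a p x → Related x) →
             Related (a + p * + j) × Related (a + p * + suc j)
  restrict all = all _ (j , j∈ , refl) , all _ (suc j , j+1∈ , refl)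
  extend : Related (a + p * + j) × Related (a + p * + suc j) →
           ∀ x → InAP s a p x → Related x
  extend (at-j , at-j+1) _ (t , _ , refl) =
    progression-two-point Φ r a₁ b₁ a₂ b₂ a p (+ j) at-j at-j+1 (+ t)
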